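{- Let $\mathcal{F}$ be an $n\times m$ Ferrers diagram and let $1\le d\le\min\{n,m\}$ be an integer. Then $$\kappa(\mathcal{F},d)\ge\sum_{i=1}^{m+n-1}\max\{0,|D_i\cap\mathcal{F}|-d+1\}.$$
   Context: For a positive integer $i$, $[i]=\{1,\dots,i\}$. An $n\times m$ Ferrers diagram is a subset $\mathcal{F}\subseteq[n]\times[m]$ such that $(1,1),(n,m)\in\mathcal{F}$; if $(i,j)\in\mathcal{F}$ and $j<m$ then $(i,j+1)\in\mathcal{F}$; and if $(i,j)\in\mathcal{F}$ and $i>1$ then $(i-1,j)\in\mathcal{F}$. Let $c_j=|\{i:(i,j)\in\mathcal{F}\}|$. For $0\le j\le d-1$ set $\kappa_j(\mathcal{F},d)=\sum_{t=1}^{m-d+1+j}\max\{c_t-j,0\}$ and $\kappa(\mathcal{F},d)=\min_{0\le j\le d-1}\kappa_j(\mathcal{F},d)$. For $1\le i\le m+n-1$, $D_i=\{(a,b)\in[n]\times[m]: b-a=m-i\}$. -}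

module Defs where

open import Data.Nat using (ℕ; zero; suc; pred; _+_; _∸_; _≤_; _<_; _⊓_)
open import Data.Nat using (_≡ᵇ_)
open import Data.Bool using (Bool; true; false; if_then_else_; _∧_)
open import Data.Product using (_×_)
open import Relation.Binary.PropositionalEquality using (_≡_)

sum1 : ℕ → (ℕ → ℕ) → ℕ
sum1 zero    f = 0
sum1 (suc N) f = sum1 N f + f (suc N)

-- min_{0 ≤ j ≤ N-1} f j  (only used with N ≥ 1; value 0 for N = 0)
min0 : ℕ → (ℕ → ℕ) → ℕ
min0 zero          f = 0
min0 (suc zero)    f = f 0
min0 (suc (suc k)) f = min0 (suc k) f ⊓ f (suc k)

record Ferrers (n m : ℕ) : Set where
  field
    mem         : ℕ → ℕ → Bool
    inside      : ∀ i j → mem i j ≡ true → (1 ≤ i × i ≤ n) × (1 ≤ j × j ≤ m)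
    has11       : mem 1 1 ≡ true
    hasnm       : mem n m ≡ true
    rightClosed : ∀ i j → mem i j ≡ true → j < m → mem i (suc j) ≡ true
    upClosed    : ∀ i j → mem i j ≡ true → 1 < i → mem (pred i) j ≡ true
open Ferrers public

ind : Bool → ℕ
ind b = if b then 1 else 0

col : ∀ {n m} → Ferrers n m → ℕ → ℕ
col {n} F j = sum1 n (λ i → ind (mem F i j))

kappaJ : ∀ {n m} → Ferrers n m → ℕ → ℕ → ℕ
kappaJ {n} {m} F d j = sum1 (m ∸ d + 1 + j) (λ t → col F t ∸ j)

kappa : ∀ {n m} → Ferrers n m → ℕ → ℕ
kappa F d = min0 d (kappaJ F d)

-- |D_i ∩ F|, where D_i = {(a,b) ∈ [n]×[m] : b - a = m - i}, i.e. b + i = m + a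
diagCount : ∀ {n m} → Ferrers n m → ℕ → ℕ
diagCount {n} {m} F i =
  sum1 n (λ a → sum1 m (λ b → ind (mem F a b ∧ ((b + i) ≡ᵇ (m + a)))))

-- Σ_{i=1}^{m+n-1} max{0, |D_i ∩ F| - d + 1}   (max{0,x-d+1} = (x+1) ∸ d)
diagBound : ∀ {n m} → Ferrers n m → ℕ → ℕ
diagBound {n} {m} F d = sum1 (m + n ∸ 1) (λ i → (diagCount F i + 1) ∸ d)

-- Fix 0 ≤ j < d and put M = m - d + 1 + j, so that j + (m - M) = d - 1. On a diagonal D_i the
-- cells of F in the first j rows are at most j (one per row), and those in the last m - M
-- columns are at most m - M (one per column); all other cells of F ∩ D_i lie in the block
-- B = { (a,b) ∈ F : a > j, b ≤ M }. Hence max{0, |D_i ∩ F| - d + 1} ≤ |D_i ∩ B|, and summing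
-- over the diagonals, which partition B, gives at most |B|. Since F is closed upwards, column
-- t ≤ M of B has max{c_t - j, 0} cells, so |B| = κ_j(F,d).
module Submission where

open import Defs
open import Data.Bool using (Bool; true; false; _∧_; not)
open import Data.Nat using (ℕ; zero; suc; _+_; _*_; _∸_; _⊓_; _≤_; _<_; z≤n; s≤s; s≤s⁻¹; _<ᵇ_; _≟_)
open import Data.Nat.Properties
open import Algebra.Properties.CommutativeSemigroup +-commutativeSemigroup
  using () renaming (interchange to +-interchange)
open import Level using (0ℓ)
open import Relation.Nullary using (¬_; does; yes; no; contradiction)
open import Relation.Nullary.Reflects using (ofʸ; ofⁿ)
open import Relation.Unary using (Pred; Decidable)
open import Relation.Binary.PropositionalEquality

sum1-cong : ∀ N {f g : ℕ → ℕ} → (∀ k → f k ≡ g k) → sum1 N f ≡ sum1 N g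
sum1-cong zero    f≗g = refl
sum1-cong (suc N) f≗g = cong₂ _+_ (sum1-cong N f≗g) (f≗g (suc N))

sum1-mono-≤ : ∀ N {f g : ℕ → ℕ} → (∀ k → f k ≤ g k) → sum1 N f ≤ sum1 N g
sum1-mono-≤ zero    f≤g = z≤n
sum1-mono-≤ (suc N) f≤g = +-mono-≤ (sum1-mono-≤ N f≤g) (f≤g (suc N))

sum1-zero : ∀ N → sum1 N (λ _ → 0) ≡ 0
sum1-zero zero    = refl
sum1-zero (suc N) = trans (+-identityʳ _) (sum1-zero N)

sum1-distrib-+ : ∀ N (f g : ℕ → ℕ) → sum1 N (λ k → f k + g k) ≡ sum1 N f + sum1 N g
sum1-distrib-+ zero    f g = refl
sum1-distrib-+ (suc N) f g = trans (cong (_+ (f (suc N) + g (suc N))) (sum1-distrib-+ N f g))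
                                   (+-interchange (sum1 N f) (sum1 N g) (f (suc N)) (g (suc N)))

sum1-comm : ∀ N K (f : ℕ → ℕ → ℕ) →
  sum1 N (λ a → sum1 K (f a)) ≡ sum1 K (λ b → sum1 N (λ a → f a b))
sum1-comm zero    K f = sym (sum1-zero K)
sum1-comm (suc N) K f = trans (cong (_+ sum1 K (f (suc N))) (sum1-comm N K f))
                              (sym (sum1-distrib-+ K (λ b → sum1 N (λ a → f a b)) (f (suc N))))

gridSum : ℕ → ℕ → (ℕ → ℕ → ℕ) → ℕ
gridSum N K f = sum1 N (λ a → sum1 K (f a))

gridSum-mono-≤ : ∀ N K {f g : ℕ → ℕ → ℕ} → (∀ a b → f a b ≤ g a b) → gridSum N K f ≤ gridSum N K g
gridSum-mono-≤ N K f≤g = sum1-mono-≤ N (λ a → sum1-mono-≤ K (f≤g a))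

gridSum-distrib-+ : ∀ N K (f g : ℕ → ℕ → ℕ) →
  gridSum N K (λ a b → f a b + g a b) ≡ gridSum N K f + gridSum N K g
gridSum-distrib-+ N K f g = trans (sum1-cong N (λ a → sum1-distrib-+ K (f a) (g a)))
                                  (sum1-distrib-+ N (λ a → sum1 K (f a)) (λ a → sum1 K (g a)))

sum1-gridSum-comm : ∀ L N K (f : ℕ → ℕ → ℕ → ℕ) →
  sum1 L (λ i → gridSum N K (f i)) ≡ gridSum N K (λ a b → sum1 L (λ i → f i a b))
sum1-gridSum-comm L N K f = trans (sum1-comm L N _) (sum1-cong N (λ a → sum1-comm L K (λ i → f i a)))

module _ {P : Pred ℕ 0ℓ} (P? : Decidable P) where

  sum1-ind-≡0 : ∀ N → (∀ {k} → k ≤ N → ¬ P k) → sum1 N (λ k → ind (does (P? k))) ≡ 0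
  sum1-ind-≡0 zero    none = refl
  sum1-ind-≡0 (suc N) none with P? (suc N)
  ... | yes p = contradiction p (none ≤-refl)
  ... | no  _ = trans (+-identityʳ _) (sum1-ind-≡0 N (λ k≤N → none (m≤n⇒m≤1+n k≤N)))

  sum1-ind-≤1 : (∀ {k k′} → P k → P k′ → k ≡ k′) → ∀ N → sum1 N (λ k → ind (does (P? k))) ≤ 1
  sum1-ind-≤1 unique zero    = z≤n
  sum1-ind-≤1 unique (suc N) with P? (suc N)
  ... | yes p = ≤-reflexive (cong (_+ 1) (sum1-ind-≡0 N (λ k≤N q → <⇒≢ (s≤s k≤N) (unique q p))))
  ... | no  _ = ≤-trans (≤-reflexive (+-identityʳ _)) (sum1-ind-≤1 unique N)

sum1-ind-∧-≤ : ∀ N w (e : ℕ → Bool) → sum1 N (λ k → ind (e k)) ≤ 1 → sum1 N (λ k → ind (w ∧ e k)) ≤ ind w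
sum1-ind-∧-≤ N false e _   = ≤-reflexive (sum1-zero N)
sum1-ind-∧-≤ N true  e ≤1 = ≤1

gridSum-rows-≤ : ∀ N K (r : ℕ → Bool) (e : ℕ → ℕ → Bool) → (∀ a → sum1 K (λ b → ind (e a b)) ≤ 1) →
  gridSum N K (λ a b → ind (r a ∧ e a b)) ≤ sum1 N (λ a → ind (r a))
gridSum-rows-≤ N K r e rowUnique = sum1-mono-≤ N (λ a → sum1-ind-∧-≤ K (r a) (e a) (rowUnique a))

gridSum-columns-≤ : ∀ N K (c : ℕ → Bool) (e : ℕ → ℕ → Bool) → (∀ b → sum1 N (λ a → ind (e a b)) ≤ 1) →
  gridSum N K (λ a b → ind (c b ∧ e a b)) ≤ sum1 K (λ b → ind (c b))
gridSum-columns-≤ N K c e columnUnique =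
  ≤-trans (≤-reflexive (sum1-comm N K _)) (gridSum-rows-≤ K N c (λ b a → e a b) columnUnique)

sum1-ind-atMost : ∀ j N → sum1 N (λ a → ind (not (j <ᵇ a))) ≡ N ⊓ j
sum1-ind-atMost j zero    = refl
sum1-ind-atMost j (suc N) with j <ᵇ suc N | <ᵇ-reflects-< j (suc N)
... | true | ofʸ j<1+N = begin
  sum1 N _ + 0 ≡⟨ +-identityʳ _ ⟩
  sum1 N _     ≡⟨ sum1-ind-atMost j N ⟩
  N ⊓ j        ≡⟨ m≥n⇒m⊓n≡n (s≤s⁻¹ j<1+N) ⟩
  j            ≡⟨ m≥n⇒m⊓n≡n (<⇒≤ j<1+N) ⟨
  suc N ⊓ j    ∎
  where open ≡-Reasoning
... | false | ofⁿ j≮1+N = begin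
  sum1 N _ + 1 ≡⟨ cong (_+ 1) (sum1-ind-atMost j N) ⟩
  N ⊓ j + 1    ≡⟨ cong (_+ 1) (m≤n⇒m⊓n≡m (≤-trans (n≤1+n N) 1+N≤j)) ⟩
  N + 1        ≡⟨ +-comm N 1 ⟩
  suc N        ≡⟨ m≤n⇒m⊓n≡m 1+N≤j ⟨
  suc N ⊓ j    ∎
  where
  open ≡-Reasoning
  1+N≤j : suc N ≤ j
  1+N≤j = s≤s⁻¹ (≰⇒> j≮1+N)

sum1-ind-above : ∀ M K → sum1 K (λ b → ind (M <ᵇ b)) ≡ K ∸ M
sum1-ind-above M zero    = sym (0∸n≡0 M)
sum1-ind-above M (suc K) with M <ᵇ suc K | <ᵇ-reflects-< M (suc K)
... | true | ofʸ M<1+K = begin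
  sum1 K _ + 1   ≡⟨ cong (_+ 1) (sum1-ind-above M K) ⟩
  K ∸ M + 1      ≡⟨ +-comm (K ∸ M) 1 ⟩
  suc (K ∸ M)    ≡⟨ +-∸-assoc 1 (s≤s⁻¹ M<1+K) ⟨
  suc K ∸ M      ∎
  where open ≡-Reasoning
... | false | ofⁿ M≮1+K = begin
  sum1 K _ + 0 ≡⟨ +-identityʳ _ ⟩
  sum1 K _     ≡⟨ sum1-ind-above M K ⟩
  K ∸ M        ≡⟨ m≤n⇒m∸n≡0 (≤-trans (n≤1+n K) 1+K≤M) ⟩
  0            ≡⟨ m≤n⇒m∸n≡0 1+K≤M ⟨
  suc K ∸ M    ∎
  where
  open ≡-Reasoning
  1+K≤M : suc K ≤ M
  1+K≤M = s≤s⁻¹ (≰⇒> M≮1+K)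

sum1-restrict : ∀ M K (g : ℕ → ℕ) → sum1 K (λ b → ind (not (M <ᵇ b)) * g b) ≡ sum1 (K ⊓ M) g
sum1-restrict M zero    g = refl
sum1-restrict M (suc K) g with M <ᵇ suc K | <ᵇ-reflects-< M (suc K)
... | true | ofʸ M<1+K = begin
  sum1 K _ + 0         ≡⟨ +-identityʳ _ ⟩
  sum1 K _             ≡⟨ sum1-restrict M K g ⟩
  sum1 (K ⊓ M) g       ≡⟨ cong (λ L → sum1 L g) (m≥n⇒m⊓n≡n (s≤s⁻¹ M<1+K)) ⟩
  sum1 M g             ≡⟨ cong (λ L → sum1 L g) (m≥n⇒m⊓n≡n (<⇒≤ M<1+K)) ⟨
  sum1 (suc K ⊓ M) g   ∎
  where open ≡-Reasoning
... | false | ofⁿ M≮1+K = begin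
  sum1 K _ + (g (suc K) + 0) ≡⟨ cong₂ _+_ (sum1-restrict M K g) (+-identityʳ _) ⟩
  sum1 (K ⊓ M) g + g (suc K) ≡⟨ cong (λ L → sum1 L g + g (suc K)) (m≤n⇒m⊓n≡m (≤-trans (n≤1+n K) 1+K≤M)) ⟩
  sum1 (suc K) g             ≡⟨ cong (λ L → sum1 L g) (m≤n⇒m⊓n≡m 1+K≤M) ⟨
  sum1 (suc K ⊓ M) g         ∎
  where
  open ≡-Reasoning
  1+K≤M : suc K ≤ M
  1+K≤M = s≤s⁻¹ (≰⇒> M≮1+K)

DownClosed : (ℕ → Bool) → Set
DownClosed p = ∀ a → p (suc (suc a)) ≡ true → p (suc a) ≡ true

sum1-ind-initial : ∀ {p} → DownClosed p → ∀ N → p (suc N) ≡ true → sum1 N (λ a → ind (p a)) ≡ N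
sum1-ind-initial closed zero    _   = refl
sum1-ind-initial closed (suc N) top = begin
  sum1 N _ + ind _ ≡⟨ cong₂ _+_ (sum1-ind-initial closed N (closed N top)) (cong ind (closed N top)) ⟩
  N + 1            ≡⟨ +-comm N 1 ⟩
  suc N            ∎
  where open ≡-Reasoning

sum1-ind-∧-above : ∀ {p} → DownClosed p → ∀ j N →
  sum1 N (λ a → ind (p a ∧ (j <ᵇ a))) ≤ sum1 N (λ a → ind (p a)) ∸ j
sum1-ind-∧-above closed j zero = z≤n
sum1-ind-∧-above {p} closed j (suc N) with p (suc N) in top
... | false = begin
  sum1 N above + 0     ≡⟨ +-identityʳ _ ⟩
  sum1 N above         ≤⟨ sum1-ind-∧-above closed j N ⟩
  sum1 N column ∸ j    ≡⟨ cong (_∸ j) (+-identityʳ _) ⟨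
  sum1 N column + 0 ∸ j ∎
  where
  open ≤-Reasoning
  above column : ℕ → ℕ
  above a = ind (p a ∧ (j <ᵇ a))
  column a = ind (p a)
... | true with j <ᵇ suc N | <ᵇ-reflects-< j (suc N)
...   | false | ofⁿ _ = ≤-trans (≤-reflexive (+-identityʳ _))
                       (≤-trans (sum1-ind-∧-above closed j N) (∸-monoˡ-≤ j (m≤m+n _ 1)))
...   | true | ofʸ j<1+N = ≤-trans (+-monoˡ-≤ 1 (sum1-ind-∧-above closed j N))
                            (≤-reflexive (sym (+-∸-comm 1 j≤column)))
  where
  j≤column : j ≤ sum1 N (λ a → ind (p a))
  j≤column = subst (j ≤_) (sym (sum1-ind-initial closed N top)) (s≤s⁻¹ j<1+N)

ind-∧-split : ∀ x r c e →
  ind (x ∧ e) ≤ ind (not r ∧ e) + ind (c ∧ e) + ind ((not c ∧ x ∧ r) ∧ e)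
ind-∧-split false r     c     e     = z≤n
ind-∧-split true  r     c     false = z≤n
ind-∧-split true  false false true  = s≤s z≤n
ind-∧-split true  false true  true  = s≤s z≤n
ind-∧-split true  true  false true  = s≤s z≤n
ind-∧-split true  true  true  true  = s≤s z≤n

+1-∸-+1-≤ : ∀ {D k X} → D ≤ k + X → (D + 1) ∸ (k + 1) ≤ X
+1-∸-+1-≤ {D} {k} {X} D≤k+X =
  subst (_≤ X) (cong₂ _∸_ (+-comm 1 D) (+-comm 1 k)) (m≤n+o⇒m∸n≤o D k D≤k+X)

column-downClosed : ∀ {n m} (F : Ferrers n m) b → DownClosed (λ a → mem F a b)
column-downClosed F b a top = upClosed F (suc (suc a)) b top (s≤s (s≤s z≤n))

module _ {n m : ℕ} (F : Ferrers n m) (j M : ℕ) where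

  -- does (x ≟ y) computes to x ≡ᵇ y, so diagCount F i is the grid sum of ind (mem F a b ∧ onDiagonal i a b).
  onDiagonal : ℕ → ℕ → ℕ → Bool
  onDiagonal i a b = does (b + i ≟ m + a)

  inBlock : ℕ → ℕ → Bool
  inBlock a b = not (M <ᵇ b) ∧ mem F a b ∧ (j <ᵇ a)

  blockDiagCount : ℕ → ℕ
  blockDiagCount i = gridSum n m (λ a b → ind (inBlock a b ∧ onDiagonal i a b))

  diagCount-≤ : ∀ i → diagCount F i ≤ j + (m ∸ M) + blockDiagCount i
  diagCount-≤ i = begin
    diagCount F i
      ≤⟨ gridSum-mono-≤ n m (λ a b → ind-∧-split (mem F a b) (laterRow a) (laterColumn b) (onDiagonal i a b)) ⟩
    gridSum n m (λ a b → ind (not (laterRow a) ∧ onDiagonal i a b) + ind (laterColumn b ∧ onDiagonal i a b)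
                          + ind (inBlock a b ∧ onDiagonal i a b))
      ≡⟨ trans (gridSum-distrib-+ n m _ _) (cong (_+ blockDiagCount i) (gridSum-distrib-+ n m _ _)) ⟩
    gridSum n m (λ a b → ind (not (laterRow a) ∧ onDiagonal i a b))
      + gridSum n m (λ a b → ind (laterColumn b ∧ onDiagonal i a b)) + blockDiagCount i
      ≤⟨ +-monoˡ-≤ _ (+-mono-≤ firstRows-≤ lastColumns-≤) ⟩
    j + (m ∸ M) + blockDiagCount i ∎
    where
    open ≤-Reasoning
    laterRow laterColumn : ℕ → Bool
    laterRow a = j <ᵇ a
    laterColumn b = M <ᵇ b
    firstRows-≤ : gridSum n m (λ a b → ind (not (laterRow a) ∧ onDiagonal i a b)) ≤ j
    firstRows-≤ = begin
      _     ≤⟨ gridSum-rows-≤ n m _ (onDiagonal i) (λ a →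
                 sum1-ind-≤1 (λ b → b + i ≟ m + a) (λ p q → +-cancelʳ-≡ i _ _ (trans p (sym q))) m) ⟩
      _     ≡⟨ sum1-ind-atMost j n ⟩
      n ⊓ j ≤⟨ m⊓n≤n n j ⟩
      j     ∎
    lastColumns-≤ : gridSum n m (λ a b → ind (laterColumn b ∧ onDiagonal i a b)) ≤ m ∸ M
    lastColumns-≤ = begin
      _     ≤⟨ gridSum-columns-≤ n m _ (onDiagonal i) (λ b →
                 sum1-ind-≤1 (λ a → b + i ≟ m + a) (λ p q → +-cancelˡ-≡ m _ _ (trans (sym p) q)) n) ⟩
      _     ≡⟨ sum1-ind-above M m ⟩
      m ∸ M ∎

  sum1-blockDiagCount-≤ : ∀ K → sum1 K blockDiagCount ≤ gridSum n m (λ a b → ind (inBlock a b))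
  sum1-blockDiagCount-≤ K = ≤-trans (≤-reflexive (sum1-gridSum-comm K n m _)) (gridSum-mono-≤ n m (λ a b →
    sum1-ind-∧-≤ K (inBlock a b) (λ i → onDiagonal i a b)
      (sum1-ind-≤1 (λ i → b + i ≟ m + a) (λ p q → +-cancelˡ-≡ b _ _ (trans p (sym q))) K)))

  block-≤-kappaJ : M ≤ m → gridSum n m (λ a b → ind (inBlock a b)) ≤ sum1 M (λ t → col F t ∸ j)
  block-≤-kappaJ M≤m = begin
    gridSum n m (λ a b → ind (inBlock a b))                  ≡⟨ sum1-comm n m _ ⟩
    sum1 m (λ b → sum1 n (λ a → ind (inBlock a b)))          ≤⟨ sum1-mono-≤ m blockColumn-≤ ⟩
    sum1 m (λ b → ind (not (M <ᵇ b)) * (col F b ∸ j))        ≡⟨ sum1-restrict M m _ ⟩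
    sum1 (m ⊓ M) (λ t → col F t ∸ j)                         ≡⟨ cong (λ L → sum1 L _) (m≥n⇒m⊓n≡n M≤m) ⟩
    sum1 M (λ t → col F t ∸ j)                               ∎
    where
    open ≤-Reasoning
    blockColumn-≤ : ∀ b → sum1 n (λ a → ind (inBlock a b)) ≤ ind (not (M <ᵇ b)) * (col F b ∸ j)
    blockColumn-≤ b with M <ᵇ b
    ... | true  = ≤-reflexive (sum1-zero n)
    ... | false = ≤-trans (sum1-ind-∧-above (column-downClosed F b) j n) (≤-reflexive (sym (+-identityʳ _)))

  diagonalExcess-≤-block : M ≤ m → ∀ K →
    sum1 K (λ i → (diagCount F i + 1) ∸ (j + (m ∸ M) + 1)) ≤ sum1 M (λ t → col F t ∸ j)
  diagonalExcess-≤-block M≤m K = begin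
    sum1 K (λ i → (diagCount F i + 1) ∸ (j + (m ∸ M) + 1)) ≤⟨ sum1-mono-≤ K (λ i → +1-∸-+1-≤ (diagCount-≤ i)) ⟩
    sum1 K blockDiagCount                                   ≤⟨ sum1-blockDiagCount-≤ K ⟩
    gridSum n m (λ a b → ind (inBlock a b))                 ≤⟨ block-≤-kappaJ M≤m ⟩
    sum1 M (λ t → col F t ∸ j)                              ∎
    where open ≤-Reasoning

module _ {j d m : ℕ} (j<d : j < d) (d≤m : d ≤ m) where

  kappaJ-length-≤ : m ∸ d + 1 + j ≤ m
  kappaJ-length-≤ = begin
    m ∸ d + 1 + j   ≡⟨ +-assoc (m ∸ d) 1 j ⟩
    m ∸ d + suc j   ≤⟨ +-monoʳ-≤ (m ∸ d) j<d ⟩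
    m ∸ d + d       ≡⟨ m∸n+n≡m d≤m ⟩
    m               ∎
    where open ≤-Reasoning

  kappaJ-length-complement : j + (m ∸ (m ∸ d + 1 + j)) + 1 ≡ d
  kappaJ-length-complement = begin
    j + (m ∸ (m ∸ d + 1 + j)) + 1 ≡⟨ cong (λ L → j + (m ∸ L) + 1) (+-assoc (m ∸ d) 1 j) ⟩
    j + (m ∸ (m ∸ d + suc j)) + 1 ≡⟨ cong (λ x → j + x + 1) (∸-+-assoc m (m ∸ d) (suc j)) ⟨
    j + (m ∸ (m ∸ d) ∸ suc j) + 1 ≡⟨ cong (λ x → j + (x ∸ suc j) + 1) (m∸[m∸n]≡n d≤m) ⟩
    j + (d ∸ suc j) + 1           ≡⟨ +-comm (j + (d ∸ suc j)) 1 ⟩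
    suc j + (d ∸ suc j)           ≡⟨ m+[n∸m]≡n j<d ⟩
    d                             ∎
    where open ≡-Reasoning

diagBound-≤-kappaJ : ∀ {n m} (F : Ferrers n m) {d j} → j < d → d ≤ m → diagBound F d ≤ kappaJ F d j
diagBound-≤-kappaJ {n} {m} F {d} {j} j<d d≤m =
  subst (λ e → sum1 (m + n ∸ 1) (λ i → (diagCount F i + 1) ∸ e) ≤ kappaJ F d j)
        (kappaJ-length-complement j<d d≤m)
        (diagonalExcess-≤-block F j (m ∸ d + 1 + j) (kappaJ-length-≤ j<d d≤m) (m + n ∸ 1))

min0-glb : ∀ {X} d (f : ℕ → ℕ) → 1 ≤ d → (∀ {j} → j < d → X ≤ f j) → X ≤ min0 d f
min0-glb (suc zero)    f _ X≤f = X≤f (s≤s z≤n)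
min0-glb (suc (suc k)) f _ X≤f = ⊓-glb (min0-glb (suc k) f (s≤s z≤n) (λ j<1+k → X≤f (m≤n⇒m≤1+n j<1+k)))
                                       (X≤f ≤-refl)

proposition2p17 : ∀ (n m : ℕ) (F : Ferrers n m) (d : ℕ) →
    1 ≤ d → d ≤ n ⊓ m → diagBound F d ≤ kappa F d
proposition2p17 n m F d 1≤d d≤n⊓m =
  min0-glb d (kappaJ F d) 1≤d (λ j<d → diagBound-≤-kappaJ F j<d (≤-trans d≤n⊓m (m⊓n≤n n m)))
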